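{- Let $H$ be a connected hypergraph with a minimal edge cut $F$, and let $\{ V_i: i \in I\}$ be a partition of $V(H)$ such that each $V_i$ is a union of the vertex sets of connected components of $H \backslash F$. Then (i) $H$ has an Euler family if and only if for some edge cut assignment $\alpha: F \to I^{[2]}$, each connected component of $H^{\alpha}$ has an Euler family; and (ii) $H$ has an Euler tour if and only if for some edge cut assignment $\alpha: F \to I^{[2]}$, the hypergraph $H^{\alpha}$ has a unique non-empty connected component, and this component has an Euler tour.
   Context: A hypergraph $H=(V,E)$: non-empty finite vertex set $V$ and finite multiset $E$ of subsets of $V$ (edges). Distinct $u,v$ are adjacent via $e$ if $u,v\in e$. A walk is $v_0e_1v_1\ldots e_kv_k$ with $v_{i-1},v_i$ adjacent via $e_i$; anchors are $v_0,\dots,v_k$; closed if $v_0=v_k$, $k\ge2$; trail if edges are pairwise distinct. Connected components are maximal connected subhypergraphs without empty edges; a hypergraph is empty if it has no edges. An Euler tour is a closed trail traversing every edge; an Euler family is a set of pairwise edge-disjoint and anchor-disjoint closed trails jointly traversing every edge. For $F\subseteq E$, $H\backslash F=(V,E-F)$. An edge cut is a set $[S,V-S]_H=\{e\in E: e\cap S\ne\emptyset\ne e\cap(V-S)\}$ for non-empty proper $S\subset V$; minimal if it properly contains no other edge cut. For finite $I$, $I^{[2]}=\{ij:i,j\in I\}$ is the set of unordered pairs with repetition allowed. An edge cut assignment is a map $\alpha:F\to I^{[2]}$ such that $\alpha(f)=ij$, $i\ne j$, implies $f\cap V_i\ne\emptyset\ne f\cap V_j$, and $\alpha(f)=ii$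 implies $|f\cap V_i|\ge2$. For $e\in E$: $e^\alpha=e\cap(V_i\cup V_j)$ if $e\in F$, $\alpha(e)=ij$; $e^\alpha=e$ if $e\notin F$. $H^\alpha$ has vertex set $V(H)$ and edge multiset $\{\!\{e^\alpha:e\in E(H)\}\!\}$. -}

module Defs where

open import Data.Nat using (ℕ; zero; suc; _≤_)
open import Data.Fin using (Fin; zero; suc; inject₁; fromℕ) renaming (_≤_ to _≤ᶠ_)
open import Data.Fin.Subset using (Subset; _∈_; _∉_; _⊂_; _∩_; Nonempty)
open import Data.Fin.Subset.Properties using (_∈?_)
open import Data.Fin.Properties using (_≟_)
open import Data.Bool using (Bool; _∨_)
open import Data.Vec using (tabulate)
open import Data.Product using (Σ; ∃; ∃-syntax; _×_; _,_; proj₁; proj₂)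
open import Data.Empty using (⊥)
open import Relation.Nullary using (¬_; yes; no)
open import Relation.Nullary.Decidable using (⌊_⌋)
open import Relation.Binary.PropositionalEquality using (_≡_; _≢_)
open import Relation.Unary using (Pred)
open import Function using (_⇔_)
open import Function.Definitions using (Injective)
open import Level using (0ℓ)

-- A hypergraph on vertex set Fin n with edge multiset indexed by Fin m:
-- the edges are  E e : Subset n  for  e : Fin m  (repetitions allowed).
-- Sub-hypergraphs on the same vertex set are described by a "mask"
-- M : Pred (Fin m) 0ℓ selecting which edge indices are present.

Edges : ℕ → ℕ → Set
Edges n m = Fin m → Subset n

Mask : ℕ → Set₁
Mask m = Pred (Fin m) 0ℓ

full : ∀ {m} → Mask m
full _ = Data.Unit.⊤ where import Data.Unit

-- Walks  v₀ e₁ v₁ … e_k v_k  using only edges of the mask.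
-- anchor i = v_i (i = 0..k),  edg i = e_{i+1} (i = 0..k-1).

record Walk {n m} (E : Edges n m) (M : Mask m) : Set where
  field
    len    : ℕ
    anchor : Fin (suc len) → Fin n
    edg    : Fin len → Fin m
    inMask : ∀ i → M (edg i)
    adjDistinct : ∀ i → anchor (inject₁ i) ≢ anchor (suc i)
    adjIn₁ : ∀ i → anchor (inject₁ i) ∈ E (edg i)
    adjIn₂ : ∀ i → anchor (suc i) ∈ E (edg i)

  first : Fin n
  first = anchor zero

  last : Fin n
  last = anchor (fromℕ len)

  IsClosed : Set
  IsClosed = (2 ≤ len) × (first ≡ last)

  IsTrail : Set
  IsTrail = Injective _≡_ _≡_ edg

  IsClosedTrail : Set
  IsClosedTrail = IsClosed × IsTrail

  HasAnchor : Fin n → Set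
  HasAnchor v = ∃[ i ] anchor i ≡ v

  Traverses : Fin m → Set
  Traverses e = ∃[ i ] edg i ≡ e

open Walk public

Connected : ∀ {n m} → Edges n m → Mask m → Fin n → Fin n → Set
Connected E M u v = Σ (Walk E M) λ W → (first W ≡ u) × (last W ≡ v)

IsConnected : ∀ {n m} → Edges n m → Mask m → Set
IsConnected E M = ∀ u v → Connected E M u v

EulerTour : ∀ {n m} → Edges n m → Mask m → Set
EulerTour E M =
  Σ (Walk E M) λ W → IsClosedTrail W × (∀ e → M e → Traverses W e)

record EulerFamily {n m} (E : Edges n m) (M : Mask m) : Set where
  field
    count   : ℕ
    trail   : Fin count → Walk E M
    closed  : ∀ a → IsClosedTrail (trail a)
    edgeDisjoint   : ∀ a b → a ≢ b → ∀ e → Traverses (trail a) e → ¬ Traverses (trail b) e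
    anchorDisjoint : ∀ a b → a ≢ b → ∀ v → HasAnchor (trail a) v → ¬ HasAnchor (trail b) v
    covers  : ∀ e → M e → ∃[ a ] Traverses (trail a) e

-- The vertex set of the connected component
-- containing c is the class {v | Connected E M c v}; its edges are the
-- non-empty edges of the mask all of whose vertices lie in that class
-- (components have no empty edges).

componentMask : ∀ {n m} → Edges n m → Mask m → Fin n → Mask m
componentMask E M c e = M e × Nonempty (E e) × (∀ v → v ∈ E e → Connected E M c v)

NonEmptyComponent : ∀ {n m} → Edges n m → Mask m → Fin n → Set
NonEmptyComponent E M c = ∃[ e ] componentMask E M c e

-- Edge cuts (sets of edge indices, since E is a multiset)

IsCutOf : ∀ {n m} → Edges n m → Subset n → Subset m → Set
IsCutOf E S F = ∀ e → e ∈ F ⇔ ((∃[ u ] u ∈ E e × u ∈ S) × (∃[ v ] v ∈ E e × v ∉ S))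

IsEdgeCut : ∀ {n m} → Edges n m → Subset m → Set
IsEdgeCut {n} E F =
  Σ (Subset n) λ S → (∃[ s ] s ∈ S) × (∃[ t ] t ∉ S) × IsCutOf E S F

IsMinimalEdgeCut : ∀ {n m} → Edges n m → Subset m → Set
IsMinimalEdgeCut E F = IsEdgeCut E F × (∀ F' → IsEdgeCut E F' → ¬ (F' ⊂ F))

deleteMask : ∀ {m} → Subset m → Mask m
deleteMask F e = e ∉ F

-- Partition {V_i : i ∈ Fin p} of V given by the block map  part : Fin n → Fin p
-- (V_i = {v | part v ≡ i}); blocks are non-empty.

IsPartitionMap : ∀ {n p} → (Fin n → Fin p) → Set
IsPartitionMap {n} {p} part = ∀ (i : Fin p) → ∃[ v ] part v ≡ i

-- I^[2]: unordered pairs ij with repetition, represented by (i , j) with i ≤ j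
Pair2 : ℕ → Set
Pair2 p = Σ (Fin p × Fin p) λ ij → proj₁ ij ≤ᶠ proj₂ ij

Assignment : ∀ {m} → Subset m → ℕ → Set
Assignment {m} F p = (e : Fin m) → e ∈ F → Pair2 p

IsEdgeCutAssignment : ∀ {n m p} → Edges n m → (Fin n → Fin p) → (F : Subset m) → Assignment F p → Set
IsEdgeCutAssignment {n} E part F α = ∀ e (eF : e ∈ F) →
  let i = proj₁ (proj₁ (α e eF)) ; j = proj₂ (proj₁ (α e eF)) in
  (i ≢ j → (∃[ u ] u ∈ E e × part u ≡ i) × (∃[ v ] v ∈ E e × part v ≡ j)) ×
  (i ≡ j → ∃[ u ] ∃[ v ] u ≢ v × u ∈ E e × v ∈ E e × part u ≡ i × part v ≡ i)

blocks : ∀ {n p} → (Fin n → Fin p) → Fin p → Fin p → Subset n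
blocks part i j = tabulate λ v → ⌊ part v ≟ i ⌋ ∨ ⌊ part v ≟ j ⌋

edgeα : ∀ {n m p} → Edges n m → (Fin n → Fin p) → (F : Subset m) → Assignment F p → Edges n m
edgeα E part F α e with e ∈? F
... | yes eF = E e ∩ blocks part (proj₁ (proj₁ (α e eF))) (proj₂ (proj₁ (α e eF)))
... | no _   = E e

-- Given an Euler family of H (an Euler tour is a family with one trail), every edge f is traversed
-- exactly once, between two distinct anchors u and w; setting α(f) = {part u, part w} keeps both in
-- f^α, so every trail is still a trail of H^α. Restricting this family to the components of H^α, or
-- noting that a single closed trail stays inside one component, gives the right-hand sides.
-- Conversely f^α ⊆ f, so closed trails of H^α are closed trails of H. Closed trails in distinct
-- components share no edge or anchor, so the families of the components, one per component taken at
-- its least vertex, glue to an Euler family of H; and a tour of the unique non-empty component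
-- traverses every edge.

module Submission where

open import Defs

open import Data.Bool using (true; _∨_)
open import Data.Bool.Properties using (T-≡)
open import Data.Empty using (⊥-elim)
open import Data.Fin using (Fin; zero; suc; inject₁; fromℕ; fromℕ<; Fin′; inject; compare; less; equal; greater;
  _↑ˡ_; _↑ʳ_; splitAt)
open import Data.Fin.Properties using (any?; all?; _≟_; ¬∀⟶∃¬-smallest; splitAt-↑ˡ; splitAt-↑ʳ; splitAt⁻¹-↑ˡ;
  splitAt⁻¹-↑ʳ) renaming (_≤?_ to _≤ᶠ?_)
open import Data.Fin.Subset using (Subset; _∈_; ⁅_⁆; ∣_∣; Nonempty)
open import Data.Fin.Subset.Properties using (_∈?_; x∈p∩q⁺; x∈p∩q⁻; x∈⁅x⁆; x∈⁅y⁆⇒x≡y; ∣⁅x⁆∣≡1; ∣p∣≤n;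
  p⊂q⇒∣p∣<∣q∣)
open import Data.List using (List; filter; allFin; lookup; length)
open import Data.List.Membership.Propositional.Properties using (∈-lookup; ∈-allFin; ∈-filter⁺; ∈-filter⁻)
import Data.List.Relation.Unary.All as All
open import Data.List.Relation.Unary.AllPairs using (_∷_)
open import Data.List.Relation.Unary.Any using (index)
open import Data.List.Relation.Unary.Any.Properties using (lookup-index)
open import Data.List.Relation.Unary.Unique.Propositional using (Unique)
import Data.List.Relation.Unary.Unique.Propositional.Properties as Unique
open import Data.Nat using (ℕ; zero; suc; _+_; _≤_; _<_; z≤n; s≤s)
import Data.Nat.Properties as ℕ
open import Data.Product using (Σ; Σ-syntax; ∃; ∃-syntax; _×_; _,_; proj₁; proj₂; map₂)
open import Data.Sum using (_⊎_; inj₁; inj₂; [_,_]; swap)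
open import Data.Unit using (tt)
open import Data.Vec using (tabulate)
open import Data.Vec.Properties using (lookup∘tabulate; []=⇒lookup; lookup⇒[]=)
open import Function using (_⇔_; mk⇔; Equivalence; _∘_)
open import Function.Definitions using (Injective)
open import Level using (0ℓ)
open import Relation.Binary using (Rel; Decidable)
open import Relation.Binary.Construct.Closure.ReflexiveTransitive using (Star; ε; _◅_; _◅◅_; reverse)
open import Relation.Binary.PropositionalEquality using (_≡_; _≢_; refl; sym; trans; cong; subst)
open import Relation.Nullary using (¬_; yes; no)
open import Relation.Nullary.Decidable using (⌊_⌋; _⊎-dec_; _×-dec_; ¬?; dec-true; isYes≗does; toWitness;
  decidable-stable) renaming (map to map-dec)
open import Relation.Unary using (Pred)
import Relation.Unary as U

∈-tabulate : ∀ {ℓ n} {P : Pred (Fin n) ℓ} (P? : U.Decidable P) {v : Fin n} →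
  v ∈ tabulate (λ x → ⌊ P? x ⌋) ⇔ P v
∈-tabulate P? {v} = mk⇔
  (λ v∈ → toWitness (Equivalence.from T-≡ (trans (sym (lookup∘tabulate _ v)) ([]=⇒lookup v∈))))
  (λ Pv → lookup⇒[]= v _ (trans (lookup∘tabulate _ v) (trans (isYes≗does (P? v)) (dec-true (P? v) Pv))))

module Reachability {ℓ N} {R : Rel (Fin N) ℓ} (R? : Decidable R) where

  Closed : Subset N → Set ℓ
  Closed S = ∀ {u v} → u ∈ S → R u v → v ∈ S

  Grows : Subset N → Fin N → Set ℓ
  Grows S v = v ∈ S ⊎ ∃[ u ] u ∈ S × R u v

  grows? : ∀ S → U.Decidable (Grows S)
  grows? S v = (v ∈? S) ⊎-dec any? (λ u → (u ∈? S) ×-dec R? u v)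

  grow : Subset N → Subset N
  grow S = tabulate λ v → ⌊ grows? S v ⌋

  ∈-grow : ∀ {S v} → v ∈ grow S ⇔ Grows S v
  ∈-grow {S} = ∈-tabulate (grows? S)

  ⊆-grow : ∀ {S v} → v ∈ S → v ∈ grow S
  ⊆-grow v∈S = Equivalence.from ∈-grow (inj₁ v∈S)

  grow-closed : ∀ {S} → Closed S → Closed (grow S)
  grow-closed {S} closed u∈ uRv with Equivalence.to ∈-grow u∈
  ... | inj₁ u∈S = ⊆-grow (closed u∈S uRv)
  ... | inj₂ (w , w∈S , wRu) = ⊆-grow (closed (closed w∈S wRu) uRv)

  closed-or-grows : ∀ S → Closed S ⊎ ∣ S ∣ < ∣ grow S ∣
  closed-or-grows S with any? (λ v → (v ∈? grow S) ×-dec ¬? (v ∈? S))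
  ... | yes (v , v∈ , v∉S) = inj₂ (p⊂q⇒∣p∣<∣q∣ (⊆-grow , v , v∈ , v∉S))
  ... | no ¬new = inj₁ λ {u} {v} u∈S uRv →
    decidable-stable (v ∈? S) λ v∉S → ¬new (v , Equivalence.from ∈-grow (inj₂ (u , u∈S , uRv)) , v∉S)

  growⁿ : ℕ → Subset N → Subset N
  growⁿ zero    S = S
  growⁿ (suc k) S = grow (growⁿ k S)

  growⁿ-closed-or-large : ∀ k S → Closed (growⁿ k S) ⊎ ∣ S ∣ + k ≤ ∣ growⁿ k S ∣
  growⁿ-closed-or-large zero    S = inj₂ (ℕ.≤-reflexive (ℕ.+-identityʳ _))
  growⁿ-closed-or-large (suc k) S with growⁿ-closed-or-large k S
  ... | inj₁ closed = inj₁ (grow-closed closed)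
  ... | inj₂ large with closed-or-grows (growⁿ k S)
  ...   | inj₁ closed = inj₁ (grow-closed closed)
  ...   | inj₂ grows  = inj₂ (ℕ.≤-trans (ℕ.≤-reflexive (ℕ.+-suc _ k)) (ℕ.≤-trans (s≤s large) grows))

  ⊆-growⁿ : ∀ k {S v} → v ∈ S → v ∈ growⁿ k S
  ⊆-growⁿ zero    v∈S = v∈S
  ⊆-growⁿ (suc k) v∈S = ⊆-grow (⊆-growⁿ k v∈S)

  growⁿ-sound : ∀ {u} k {S} → (∀ {w} → w ∈ S → Star R u w) → ∀ {v} → v ∈ growⁿ k S → Star R u v
  growⁿ-sound zero    u→S v∈ = u→S v∈
  growⁿ-sound (suc k) u→S v∈ with Equivalence.to ∈-grow v∈
  ... | inj₁ v∈′ = growⁿ-sound k u→S v∈′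
  ... | inj₂ (w , w∈ , wRv) = growⁿ-sound k u→S w∈ ◅◅ wRv ◅ ε

  closed-star : ∀ {S u v} → Closed S → u ∈ S → Star R u v → v ∈ S
  closed-star closed u∈S ε          = u∈S
  closed-star closed u∈S (uRw ◅ wv) = closed-star closed (closed u∈S uRw) wv

  reach : Fin N → Subset N
  reach u = growⁿ N ⁅ u ⁆

  reach-closed : ∀ u → Closed (reach u)
  reach-closed u with growⁿ-closed-or-large N ⁅ u ⁆
  ... | inj₁ closed = closed
  ... | inj₂ large  = ⊥-elim (ℕ.<⇒≱ (subst (λ k → k + N ≤ ∣ reach u ∣) (∣⁅x⁆∣≡1 u) large) (∣p∣≤n (reach u)))

  star? : Decidable (Star R)
  star? u v = map-dec (mk⇔ sound complete) (v ∈? reach u)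
    where
      sound : v ∈ reach u → Star R u v
      sound = growⁿ-sound N λ w∈ → subst (Star R u) (sym (x∈⁅y⁆⇒x≡y u w∈)) ε
      complete : Star R u v → v ∈ reach u
      complete = closed-star (reach-closed u) (⊆-growⁿ N (x∈⁅x⁆ u))

lookup-injective : ∀ {a} {A : Set a} {xs : List A} → Unique xs → Injective _≡_ _≡_ (lookup xs)
lookup-injective             (_   ∷ _) {zero}  {zero}  _  = refl
lookup-injective             (x≢ ∷ _) {zero}  {suc j} eq = ⊥-elim (All.lookup x≢ (∈-lookup j) eq)
lookup-injective             (x≢ ∷ _) {suc i} {zero}  eq = ⊥-elim (All.lookup x≢ (∈-lookup i) (sym eq))
lookup-injective             (_  ∷ u) {suc i} {suc j} eq = cong suc (lookup-injective u eq)

record Enumeration {ℓ N} (P : Pred (Fin N) ℓ) : Set ℓ where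
  field
    size         : ℕ
    at           : Fin size → Fin N
    at-injective : Injective _≡_ _≡_ at
    at-sat       : ∀ x → P (at x)
    at-onto      : ∀ {a} → P a → ∃[ x ] at x ≡ a

enumerate : ∀ {ℓ N} {P : Pred (Fin N) ℓ} → U.Decidable P → Enumeration P
enumerate {N = N} P? = record
  { size         = length xs
  ; at           = lookup xs
  ; at-injective = lookup-injective (Unique.filter⁺ P? (Unique.allFin⁺ N))
  ; at-sat       = λ x → proj₂ (∈-filter⁻ P? {xs = allFin N} (∈-lookup x))
  ; at-onto      = λ Pa → let a∈ = ∈-filter⁺ P? (∈-allFin _) Pa in index a∈ , sym (lookup-index a∈)
  }
  where
    xs : List (Fin N)
    xs = filter P? (allFin N)

∑ : (k : ℕ) → (Fin k → ℕ) → ℕ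
∑ zero    s = 0
∑ (suc k) s = s zero + ∑ k (s ∘ suc)

pack : ∀ k s → Σ (Fin k) (Fin ∘ s) → Fin (∑ k s)
pack (suc k) s (zero  , t) = t ↑ˡ ∑ k (s ∘ suc)
pack (suc k) s (suc x , t) = s zero ↑ʳ pack k (s ∘ suc) (x , t)

unpack : ∀ k s → Fin (∑ k s) → Σ (Fin k) (Fin ∘ s)
unpack (suc k) s i with splitAt (s zero) i
... | inj₁ t = zero , t
... | inj₂ i′ = let (x , t) = unpack k (s ∘ suc) i′ in suc x , t

unpack-pack : ∀ k s p → unpack k s (pack k s p) ≡ p
unpack-pack (suc k) s (zero , t) rewrite splitAt-↑ˡ (s zero) t (∑ k (s ∘ suc)) = refl
unpack-pack (suc k) s (suc x , t)
  rewrite splitAt-↑ʳ (s zero) (∑ k (s ∘ suc)) (pack k (s ∘ suc) (x , t))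
        | unpack-pack k (s ∘ suc) (x , t) = refl

pack-unpack : ∀ k s i → pack k s (unpack k s i) ≡ i
pack-unpack (suc k) s i with splitAt (s zero) i in eq
... | inj₁ t  = splitAt⁻¹-↑ˡ eq
... | inj₂ i′ = trans (cong (s zero ↑ʳ_) (pack-unpack k (s ∘ suc) i′)) (splitAt⁻¹-↑ʳ eq)

unpack-injective : ∀ k s → Injective _≡_ _≡_ (unpack k s)
unpack-injective k s {i} {j} eq = trans (sym (pack-unpack k s i)) (trans (cong (pack k s) eq) (pack-unpack k s j))

data Adjacent {n m} (E : Edges n m) (M : Mask m) (u w : Fin n) : Set where
  via : ∀ e → M e → u ≢ w → u ∈ E e → w ∈ E e → Adjacent E M u w

Reach : ∀ {n m} → Edges n m → Mask m → Rel (Fin n) 0ℓ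
Reach E M = Star (Adjacent E M)

module _ {n m} {E : Edges n m} {M : Mask m} where

  adjacent-sym : ∀ {u w} → Adjacent E M u w → Adjacent E M w u
  adjacent-sym (via e me u≢w u∈ w∈) = via e me (u≢w ∘ sym) w∈ u∈

  reach-sym : ∀ {u w} → Reach E M u w → Reach E M w u
  reach-sym = reverse adjacent-sym

  adjacent? : U.Decidable M → Decidable (Adjacent E M)
  adjacent? M? u w = map-dec (mk⇔ (λ (e , me , u≢w , u∈ , w∈) → via e me u≢w u∈ w∈)
                                  (λ { (via e me u≢w u∈ w∈) → e , me , u≢w , u∈ , w∈ }))
    (any? λ e → M? e ×-dec ¬? (u ≟ w) ×-dec (u ∈? E e) ×-dec (w ∈? E e))

  reach? : U.Decidable M → Decidable (Reach E M)
  reach? M? = Reachability.star? (adjacent? M?)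

  co-member⇒reach : ∀ {e x y} → M e → x ∈ E e → y ∈ E e → Reach E M x y
  co-member⇒reach {x = x} {y} me x∈ y∈ with x ≟ y
  ... | yes refl = ε
  ... | no x≢y   = via _ me x≢y x∈ y∈ ◅ ε

  walk⇒reach : (W : Walk E M) → ∀ i → Reach E M (first W) (anchor W i)
  walk⇒reach W = chain (anchor W) λ j → via (edg W j) (inMask W j) (adjDistinct W j) (adjIn₁ W j) (adjIn₂ W j)
    where
      chain : ∀ {l} (x : Fin (suc l) → Fin n) → (∀ j → Adjacent E M (x (inject₁ j)) (x (suc j))) →
              ∀ i → Reach E M (x zero) (x i)
      chain             x adj zero    = ε
      chain {l = suc l} x adj (suc i) = adj zero ◅ chain (x ∘ suc) (adj ∘ suc) i

  trivialWalk : Fin n → Walk E M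
  trivialWalk u = record
    { len = 0 ; anchor = λ _ → u ; edg = λ () ; inMask = λ ()
    ; adjDistinct = λ () ; adjIn₁ = λ () ; adjIn₂ = λ () }

  consWalk : ∀ {u} (W : Walk E M) → Adjacent E M u (first W) → Walk E M
  consWalk {u} W (via e me u≢w u∈ w∈) = record
    { len         = suc (len W)
    ; anchor      = λ { zero → u        ; (suc i) → anchor W i }
    ; edg         = λ { zero → e        ; (suc i) → edg W i }
    ; inMask      = λ { zero → me       ; (suc i) → inMask W i }
    ; adjDistinct = λ { zero → u≢w      ; (suc i) → adjDistinct W i }
    ; adjIn₁      = λ { zero → u∈       ; (suc i) → adjIn₁ W i }
    ; adjIn₂      = λ { zero → w∈       ; (suc i) → adjIn₂ W i } }

  reach⇒connected : ∀ {u v} → Reach E M u v → Connected E M u v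
  reach⇒connected {u} ε = trivialWalk u , refl , refl
  reach⇒connected (adj@(via _ _ _ _ _) ◅ rest) with reach⇒connected rest
  ... | W , refl , refl = consWalk W adj , refl , refl

  connected⇒reach : ∀ {u v} → Connected E M u v → Reach E M u v
  connected⇒reach (W , refl , refl) = walk⇒reach W (fromℕ (len W))

recast : ∀ {n m} {E E′ : Edges n m} {M M′ : Mask m} (W : Walk E M) →
  (∀ j → M′ (edg W j)) →
  (∀ j → anchor W (inject₁ j) ∈ E′ (edg W j)) →
  (∀ j → anchor W (suc j) ∈ E′ (edg W j)) →
  Walk E′ M′
recast W inMask′ adjIn₁′ adjIn₂′ = record
  { len = len W ; anchor = anchor W ; edg = edg W ; inMask = inMask′
  ; adjDistinct = adjDistinct W ; adjIn₁ = adjIn₁′ ; adjIn₂ = adjIn₂′ }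

anchor∈edge : ∀ {n m} {E : Edges n m} {M : Mask m} (W : Walk E M) → 0 < len W →
  ∀ i → ∃[ j ] anchor W i ∈ E (edg W j)
anchor∈edge {E = E} W = cover (λ i j → anchor W i ∈ E (edg W j)) (adjIn₁ W) (adjIn₂ W)
  where
    cover : ∀ {l} (P : Fin (suc l) → Fin l → Set) → (∀ j → P (inject₁ j) j) → (∀ j → P (suc j) j) →
            0 < l → ∀ i → ∃[ j ] P i j
    cover {suc l} P p₁ p₂ _ zero    = zero , p₁ zero
    cover {suc l} P p₁ p₂ _ (suc j) = j , p₂ j

Disjoint : ∀ {n m} {E : Edges n m} {M₁ M₂ : Mask m} → Walk E M₁ → Walk E M₂ → Set
Disjoint W₁ W₂ = (∀ e → Traverses W₁ e → ¬ Traverses W₂ e) × (∀ v → HasAnchor W₁ v → ¬ HasAnchor W₂ v)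

closedTrail⇒0<len : ∀ {n m} {E : Edges n m} {M : Mask m} (W : Walk E M) → IsClosedTrail W → 0 < len W
closedTrail⇒0<len _ ((2≤len , _) , _) = ℕ.<-trans (s≤s z≤n) 2≤len

UniqueComponentTour : ∀ {n m} → Edges n m → Mask m → Set
UniqueComponentTour E M = ∃[ c ] NonEmptyComponent E M c ×
  (∀ d → NonEmptyComponent E M d → Connected E M c d) × EulerTour E (componentMask E M c)

module _ {n m} {E : Edges n m} {M : Mask m} where

  component-edge⇒reach : ∀ {c e x} → componentMask E M c e → x ∈ E e → Reach E M c x
  component-edge⇒reach (_ , _ , connected) x∈ = connected⇒reach (connected _ x∈)

  reach⇒component-edge : ∀ {c e x} → M e → x ∈ E e → Reach E M c x → componentMask E M c e
  reach⇒component-edge me x∈ c→x = me , (_ , x∈) , λ w w∈ → reach⇒connected (c→x ◅◅ co-member⇒reach me x∈ w∈)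

  nonEmptyComponent-at : ∀ {e x} → M e → x ∈ E e → NonEmptyComponent E M x
  nonEmptyComponent-at me x∈ = _ , reach⇒component-edge me x∈ ε

  walk-in-component : ∀ {c} (W : Walk E M) → Reach E M c (first W) → ∀ j → componentMask E M c (edg W j)
  walk-in-component W c→first j =
    reach⇒component-edge (inMask W j) (adjIn₁ W j) (c→first ◅◅ walk⇒reach W (inject₁ j))

  anchor-in-component : ∀ {c} (W : Walk E (componentMask E M c)) → 0 < len W → ∀ i → Reach E M c (anchor W i)
  anchor-in-component W 0<len i with anchor∈edge W 0<len i
  ... | j , anchor∈ = component-edge⇒reach (inMask W j) anchor∈

  walks-in-separate-components-disjoint : ∀ {c d} → ¬ Reach E M c d →
    (W₁ : Walk E (componentMask E M c)) (W₂ : Walk E (componentMask E M d)) → 0 < len W₁ → 0 < len W₂ →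
    Disjoint W₁ W₂
  walks-in-separate-components-disjoint ¬c→d W₁ W₂ 0<len₁ 0<len₂ = edges , anchors
    where
      edges : ∀ e → Traverses W₁ e → ¬ Traverses W₂ e
      edges _ (j₁ , refl) (j₂ , e≡) =
        let (_ , (x , x∈) , _) = inMask W₁ j₁ in
        ¬c→d (component-edge⇒reach (inMask W₁ j₁) x∈
               ◅◅ reach-sym (component-edge⇒reach (subst (componentMask E M _) e≡ (inMask W₂ j₂)) x∈))
      anchors : ∀ v → HasAnchor W₁ v → ¬ HasAnchor W₂ v
      anchors _ (i₁ , refl) (i₂ , v≡) =
        ¬c→d (anchor-in-component W₁ 0<len₁ i₁
               ◅◅ reach-sym (subst (Reach E M _) v≡ (anchor-in-component W₂ 0<len₂ i₂)))

  tour⇒component-tour : EulerTour E M → UniqueComponentTour E M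
  tour⇒component-tour (T , closedTrail@((2≤len , _) , _) , covers) =
    first T , (edg T (fromℕ< 2≤len) , in-component (fromℕ< 2≤len)) , unique , tour
    where
      in-component : ∀ j → componentMask E M (first T) (edg T j)
      in-component = walk-in-component T ε
      unique : ∀ d → NonEmptyComponent E M d → Connected E M (first T) d
      unique d (e , de) with covers e (proj₁ de)
      ... | j , refl = reach⇒connected (walk⇒reach T (inject₁ j) ◅◅ reach-sym (component-edge⇒reach de (adjIn₁ T j)))
      tour : EulerTour E (componentMask E M (first T))
      tour = recast T in-component (adjIn₁ T) (adjIn₂ T) , closedTrail , λ e → covers e ∘ proj₁

  component-tour⇒tour : (∀ e → M e → Nonempty (E e)) → UniqueComponentTour E M → EulerTour E M
  component-tour⇒tour nonempty (_ , _ , unique , T , closedTrail , covers) =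
    recast T (proj₁ ∘ inMask T) (adjIn₁ T) (adjIn₂ T) , closedTrail , covers′
    where
      covers′ : ∀ e → M e → Traverses T e
      covers′ e me with nonempty e me
      ... | x , x∈ = covers e (reach⇒component-edge me x∈ (connected⇒reach (unique x (nonEmptyComponent-at me x∈))))

module _ {n m} {E : Edges n m} {M : Mask m} where

  open EulerFamily

  family⇒component-family : U.Decidable M → EulerFamily E M → ∀ c → EulerFamily E (componentMask E M c)
  family⇒component-family M? Φ c = record
    { count          = size
    ; trail          = λ x → recast (trail Φ (at x)) (walk-in-component (trail Φ (at x)) (at-sat x))
                                    (adjIn₁ (trail Φ (at x))) (adjIn₂ (trail Φ (at x)))
    ; closed         = closed Φ ∘ at
    ; edgeDisjoint   = λ x y x≢y → edgeDisjoint Φ (at x) (at y) (x≢y ∘ at-injective)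
    ; anchorDisjoint = λ x y x≢y → anchorDisjoint Φ (at x) (at y) (x≢y ∘ at-injective)
    ; covers         = covers′
    }
    where
      open Enumeration (enumerate λ a → reach? M? c (first (trail Φ a)))
      covers′ : ∀ e → componentMask E M c e → ∃[ x ] Traverses (trail Φ (at x)) e
      covers′ e ce with covers Φ e (proj₁ ce)
      ... | a , j , refl with at-onto (component-edge⇒reach ce (adjIn₁ (trail Φ a) j)
                                       ◅◅ reach-sym (walk⇒reach (trail Φ a) (inject₁ j)))
      ...   | x , refl = x , j , refl

  ⋃-family : ∀ {k} (M′ : Fin k → Mask m) (Φ : ∀ x → EulerFamily E (M′ x)) →
    (∀ x e → M′ x e → M e) → (∀ e → M e → ∃[ x ] M′ x e) →
    (∀ {x y} → x ≢ y → ∀ a b → Disjoint (trail (Φ x) a) (trail (Φ y) b)) →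
    EulerFamily E M
  ⋃-family {k} M′ Φ M′⊆M cover separated = record
    { count          = ∑ k sizes
    ; trail          = trailAt ∘ unpack k sizes
    ; closed         = λ i → closed (Φ (proj₁ (unpack k sizes i))) (proj₂ (unpack k sizes i))
    ; edgeDisjoint   = λ i j → proj₁ ∘ distinct i j
    ; anchorDisjoint = λ i j → proj₂ ∘ distinct i j
    ; covers         = covers′
    }
    where
      sizes : Fin k → ℕ
      sizes = count ∘ Φ
      trailAt : Σ (Fin k) (Fin ∘ sizes) → Walk E M
      trailAt p = let W = trail (Φ (proj₁ p)) (proj₂ p) in
        recast W (M′⊆M (proj₁ p) _ ∘ inMask W) (adjIn₁ W) (adjIn₂ W)
      disjoint : ∀ p q → p ≢ q → Disjoint (trailAt p) (trailAt q)
      disjoint (x , a) (y , b) p≢q with x ≟ y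
      ... | no x≢y = separated x≢y a b
      ... | yes refl with a ≟ b
      ...   | yes refl = ⊥-elim (p≢q refl)
      ...   | no a≢b   = edgeDisjoint (Φ x) a b a≢b , anchorDisjoint (Φ x) a b a≢b
      distinct : ∀ i j → i ≢ j → Disjoint (trailAt (unpack k sizes i)) (trailAt (unpack k sizes j))
      distinct i j i≢j = disjoint (unpack k sizes i) (unpack k sizes j) (i≢j ∘ unpack-injective k sizes)
      covers′ : ∀ e → M e → ∃[ i ] Traverses (trailAt (unpack k sizes i)) e
      covers′ e me with cover e me
      ... | x , m′e with covers (Φ x) e m′e
      ...   | a , traversal = pack k sizes (x , a) ,
                              subst (λ p → Traverses (trailAt p) e) (sym (unpack-pack k sizes (x , a))) traversal

  component-families⇒family : U.Decidable M → (∀ e → M e → Nonempty (E e)) →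
    (∀ c → EulerFamily E (componentMask E M c)) → EulerFamily E M
  component-families⇒family M? nonempty Ψ =
    ⋃-family (componentMask E M ∘ at) (Ψ ∘ at) (λ _ _ → proj₁) cover separated
    where
      Leader : Pred (Fin n) 0ℓ
      Leader c = (j : Fin′ c) → ¬ Reach E M (inject j) c
      open Enumeration (enumerate {P = Leader} λ c → all? λ j → ¬? (reach? M? (inject j) c))
      leader-of : ∀ v → ∃[ c ] Leader c × Reach E M c v
      leader-of v with ¬∀⟶∃¬-smallest n (λ c → ¬ Reach E M c v) (λ c → ¬? (reach? M? c v)) (λ ¬reach → ¬reach v ε)
      ... | c , ¬¬c→v , below = c , (λ j j→c → below j (j→c ◅◅ c→v)) , c→v
        where
          c→v : Reach E M c v
          c→v = decidable-stable (reach? M? c v) ¬¬c→v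
      leaders-unconnected : ∀ {c d} → Leader c → Leader d → c ≢ d → ¬ Reach E M c d
      leaders-unconnected {c} {d} Lc Ld c≢d c→d with compare c d
      ... | less _ j    = Ld j c→d
      ... | equal _     = c≢d refl
      ... | greater _ j = Lc j (reach-sym c→d)
      cover : ∀ e → M e → ∃[ x ] componentMask E M (at x) e
      cover e me with nonempty e me
      ... | v , v∈ with leader-of v
      ...   | c , Lc , c→v with at-onto Lc
      ...     | x , refl = x , reach⇒component-edge me v∈ c→v
      separated : ∀ {x y} → x ≢ y → ∀ a b → Disjoint (trail (Ψ (at x)) a) (trail (Ψ (at y)) b)
      separated {x} {y} x≢y a b =
        walks-in-separate-components-disjoint (leaders-unconnected (at-sat x) (at-sat y) (x≢y ∘ at-injective))
          W₁ W₂ (closedTrail⇒0<len W₁ (closed (Ψ (at x)) a)) (closedTrail⇒0<len W₂ (closed (Ψ (at y)) b))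
        where
          W₁ : Walk E (componentMask E M (at x))
          W₁ = trail (Ψ (at x)) a
          W₂ : Walk E (componentMask E M (at y))
          W₂ = trail (Ψ (at y)) b

module _ {n m} {E E′ : Edges n m} {M : Mask m} (E′⊆E : ∀ {e v} → v ∈ E′ e → v ∈ E e) where

  open EulerFamily

  walk-⊆ : Walk E′ M → Walk E M
  walk-⊆ W = recast W (inMask W) (E′⊆E ∘ adjIn₁ W) (E′⊆E ∘ adjIn₂ W)

  tour-⊆ : EulerTour E′ M → EulerTour E M
  tour-⊆ (T , closedTrail , covers) = walk-⊆ T , closedTrail , covers

  family-⊆ : EulerFamily E′ M → EulerFamily E M
  family-⊆ Φ = record
    { count = count Φ ; trail = walk-⊆ ∘ trail Φ ; closed = closed Φ
    ; edgeDisjoint = edgeDisjoint Φ ; anchorDisjoint = anchorDisjoint Φ ; covers = covers Φ }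

tour⇒family : ∀ {n m} {E : Edges n m} {M : Mask m} → EulerTour E M → EulerFamily E M
tour⇒family (T , closedTrail , covers) = record
  { count          = 1
  ; trail          = λ _ → T
  ; closed         = λ _ → closedTrail
  ; edgeDisjoint   = λ { zero zero 0≢0 → ⊥-elim (0≢0 refl) }
  ; anchorDisjoint = λ { zero zero 0≢0 → ⊥-elim (0≢0 refl) }
  ; covers         = λ e me → zero , covers e me
  }

record Step {n m} (E : Edges n m) (f : Fin m) : Set where
  constructor step
  field
    source target : Fin n
    distinct      : source ≢ target
    source∈       : source ∈ E f
    target∈       : target ∈ E f

  endpoints : Fin n × Fin n
  endpoints = source , target

stepAt : ∀ {n m} {E : Edges n m} {M : Mask m} {f} (W : Walk E M) → Traverses W f → Step E f
stepAt {E = E} W (j , eq) = step (anchor W (inject₁ j)) (anchor W (suc j)) (adjDistinct W j)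
  (subst (λ e → _ ∈ E e) eq (adjIn₁ W j)) (subst (λ e → _ ∈ E e) eq (adjIn₂ W j))

stepAt-trail : ∀ {n m} {E : Edges n m} {M : Mask m} (W : Walk E M) → IsTrail W →
  ∀ {j} (t : Traverses W (edg W j)) → Step.endpoints (stepAt W t) ≡ (anchor W (inject₁ j) , anchor W (suc j))
stepAt-trail W trail (_ , eq) = cong (λ k → anchor W (inject₁ k) , anchor W (suc k)) (trail eq)

sortPair : ∀ {p} → Fin p → Fin p → Pair2 p
sortPair i j with i ≤ᶠ? j
... | yes i≤j = (i , j) , i≤j
... | no  i≰j = (j , i) , ℕ.≰⇒≥ i≰j

sortPair-covers : ∀ {p} {x i j : Fin p} → x ≡ i ⊎ x ≡ j →
  x ≡ proj₁ (proj₁ (sortPair i j)) ⊎ x ≡ proj₂ (proj₁ (sortPair i j))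
sortPair-covers {i = i} {j} x∈ij with i ≤ᶠ? j
... | yes _ = x∈ij
... | no  _ = swap x∈ij

∈-blocks : ∀ {n p} (part : Fin n → Fin p) {i j v} → part v ≡ i ⊎ part v ≡ j → v ∈ blocks part i j
∈-blocks part {i} {j} {v} v∈ij = lookup⇒[]= v _ (trans (lookup∘tabulate _ v) (holds v∈ij))
  where
    holds : part v ≡ i ⊎ part v ≡ j → ⌊ part v ≟ i ⌋ ∨ ⌊ part v ≟ j ⌋ ≡ true
    holds with part v ≟ i | part v ≟ j
    ... | yes _  | _      = λ _ → refl
    ... | no _   | yes _  = λ _ → refl
    ... | no ¬vi | no ¬vj = ⊥-elim ∘ [ ¬vi , ¬vj ]

module _ {n m p} (E : Edges n m) (part : Fin n → Fin p) (F : Subset m) where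

  open Step

  Admissible : Fin m → Pair2 p → Set
  Admissible f ij =
    let i = proj₁ (proj₁ ij) ; j = proj₂ (proj₁ ij) in
    (i ≢ j → (∃[ u ] u ∈ E f × part u ≡ i) × (∃[ v ] v ∈ E f × part v ≡ j)) ×
    (i ≡ j → ∃[ u ] ∃[ v ] u ≢ v × u ∈ E f × v ∈ E f × part u ≡ i × part v ≡ i)

  sortPair-admissible : ∀ {f} (s : Step E f) → Admissible f (sortPair (part (source s)) (part (target s)))
  sortPair-admissible (step u w u≢w u∈ w∈) with part u ≤ᶠ? part w
  ... | yes _ = (λ _ → (u , u∈ , refl) , (w , w∈ , refl)) , λ i≡j → u , w , u≢w , u∈ , w∈ , refl , sym i≡j
  ... | no  _ = (λ _ → (w , w∈ , refl) , (u , u∈ , refl)) , λ i≡j → w , u , u≢w ∘ sym , w∈ , u∈ , refl , sym i≡j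

  -- The value ignores the proof of f ∈ F, so it agrees with whichever proof edgeα's decision produces.
  stepAssignment : (∀ f → Step E f) → Assignment F p
  stepAssignment s f _ = sortPair (part (source (s f))) (part (target (s f)))

  stepAssignment-isEdgeCutAssignment : ∀ s → IsEdgeCutAssignment E part F (stepAssignment s)
  stepAssignment-isEdgeCutAssignment s f _ = sortPair-admissible (s f)

  ∈-edgeα : ∀ s {f v} → v ∈ E f → part v ≡ part (source (s f)) ⊎ part v ≡ part (target (s f)) →
    v ∈ edgeα E part F (stepAssignment s) f
  ∈-edgeα s {f} v∈ v∈st with f ∈? F
  ... | yes _ = x∈p∩q⁺ (v∈ , ∈-blocks part (sortPair-covers v∈st))
  ... | no  _ = v∈

  edgeα-⊆ : ∀ {α e v} → v ∈ edgeα E part F α e → v ∈ E e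
  edgeα-⊆ {e = e} with e ∈? F
  ... | yes _ = proj₁ ∘ x∈p∩q⁻ _ _
  ... | no  _ = λ v∈ → v∈

  edgeα-nonempty : ∀ {α} → IsEdgeCutAssignment E part F α → ∀ e → Nonempty (E e) → Nonempty (edgeα E part F α e)
  edgeα-nonempty {α} admissible e nonempty with e ∈? F
  ... | no  _  = nonempty
  ... | yes e∈F with proj₁ (proj₁ (α e e∈F)) ≟ proj₂ (proj₁ (α e e∈F))
  ...   | yes i≡j = let (u , _ , _ , u∈ , _ , part-u , _) = proj₂ (admissible e e∈F) i≡j in
                    u , x∈p∩q⁺ (u∈ , ∈-blocks part (inj₁ part-u))
  ...   | no  i≢j = let ((u , u∈ , part-u) , _) = proj₁ (admissible e e∈F) i≢j in
                    u , x∈p∩q⁺ (u∈ , ∈-blocks part (inj₁ part-u))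

  walkα : ∀ {M : Mask m} (s : ∀ f → Step E f) (W : Walk E M) →
    (∀ j → endpoints (s (edg W j)) ≡ (anchor W (inject₁ j) , anchor W (suc j))) →
    Walk (edgeα E part F (stepAssignment s)) M
  walkα s W consistent = recast W (inMask W)
    (λ j → ∈-edgeα s (adjIn₁ W j) (inj₁ (cong (part ∘ proj₁) (sym (consistent j)))))
    (λ j → ∈-edgeα s (adjIn₂ W j) (inj₂ (cong (part ∘ proj₂) (sym (consistent j)))))

  module _ (Φ : EulerFamily E full) where

    open EulerFamily Φ

    familyStep : ∀ f → Step E f
    familyStep f = stepAt (trail (proj₁ (covers f tt))) (proj₂ (covers f tt))

    familyStep-consistent : ∀ a j →
      endpoints (familyStep (edg (trail a) j)) ≡ (anchor (trail a) (inject₁ j) , anchor (trail a) (suc j))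
    familyStep-consistent a j with covers (edg (trail a) j) tt
    ... | b , t with b ≟ a
    ...   | yes refl = stepAt-trail (trail a) (proj₂ (closed a)) t
    ...   | no  b≢a  = ⊥-elim (edgeDisjoint b a b≢a _ t (j , refl))

    familyα : EulerFamily (edgeα E part F (stepAssignment familyStep)) full
    familyα = record
      { count = count ; trail = λ a → walkα familyStep (trail a) (familyStep-consistent a) ; closed = closed
      ; edgeDisjoint = edgeDisjoint ; anchorDisjoint = anchorDisjoint ; covers = covers }

  family⇒assignedFamily : EulerFamily E full →
    Σ[ α ∈ Assignment F p ] IsEdgeCutAssignment E part F α × EulerFamily (edgeα E part F α) full
  family⇒assignedFamily Φ = _ , stepAssignment-isEdgeCutAssignment (familyStep Φ) , familyα Φ

  -- Every trail of familyα Φ is T itself, so the traversal returned by covers is one of T.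
  tour⇒assignedTour : EulerTour E full →
    Σ[ α ∈ Assignment F p ] IsEdgeCutAssignment E part F α × EulerTour (edgeα E part F α) full
  tour⇒assignedTour T =
    _ , stepAssignment-isEdgeCutAssignment (familyStep Φ) , trail zero , closed zero , λ e _ → proj₂ (covers e tt)
    where
      Φ : EulerFamily E full
      Φ = tour⇒family T
      open EulerFamily (familyα Φ)

theorem4p4 : ∀ {n m p} (E : Edges (suc n) m) (F : Subset m) (part : Fin (suc n) → Fin p) →
  (∀ e → Nonempty (E e)) →
  IsConnected E full →
  IsMinimalEdgeCut E F →
  IsPartitionMap part →
  (∀ u v → Connected E (deleteMask F) u v → part u ≡ part v) →
  (EulerFamily E full ⇔
    (Σ (Assignment F p) λ α → IsEdgeCutAssignment E part F α ×
      (∀ c → EulerFamily (edgeα E part F α) (componentMask (edgeα E part F α) full c))))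
  ×
  (EulerTour E full ⇔
    (Σ (Assignment F p) λ α → IsEdgeCutAssignment E part F α ×
      (∃[ c ] NonEmptyComponent (edgeα E part F α) full c ×
        (∀ d → NonEmptyComponent (edgeα E part F α) full d → Connected (edgeα E part F α) full c d) ×
        EulerTour (edgeα E part F α) (componentMask (edgeα E part F α) full c))))
theorem4p4 E F part nonempty _ _ _ _ =
  mk⇔ (map₂ (map₂ (family⇒component-family full?)) ∘ family⇒assignedFamily E part F)
      (λ (_ , admissible , Ψ) → family-⊆ (edgeα-⊆ E part F)
         (component-families⇒family full? (nonemptyα admissible) Ψ)) ,
  mk⇔ (map₂ (map₂ tour⇒component-tour) ∘ tour⇒assignedTour E part F)
      (λ (_ , admissible , U) → tour-⊆ (edgeα-⊆ E part F) (component-tour⇒tour (nonemptyα admissible) U))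
  where
    full? : U.Decidable full
    full? _ = yes tt
    nonemptyα : ∀ {α} → IsEdgeCutAssignment E part F α → ∀ e → full e → Nonempty (edgeα E part F α e)
    nonemptyα admissible e _ = edgeα-nonempty E part F admissible e (nonempty e)
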